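{- Let $G$ be a connected $P_5$-free chordal bipartite graph with bipartition $(A,B)$, let $(A_1,B_1)$ be a maximum biclique of $G$ with $A_1\subseteq A$, $B_1\subseteq B$, and suppose $A_2=A\setminus A_1$ and $B_2=B\setminus B_1$ are both nonempty. If $G$ is Hamiltonian, then $\overline{G}$ is Hamiltonian.
   Context: Graphs are finite, simple and undirected. A bipartite graph is chordal bipartite if every cycle of length at least six has a chord. $P_5$-free means no induced path on five vertices. The complement $\overline{G}$ has vertex set $V(G)$ and edge set $\{\{u,v\}: u\ne v,\ \{u,v\}\notin E(G)\}$. A biclique is a pair $(X,Y)$ with $X\subseteq A$, $Y\subseteq B$ such that every vertex of $X$ is adjacent to every vertex of $Y$; it is maximal if no vertex can be added to $X$ or to $Y$ keeping this property; following the paper, a maximum biclique is a maximal biclique $(X,Y)$ for which $\bigl||X|-|Y|\bigr|$ is minimum. -}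

module Defs where

open import Data.Nat using (ℕ; zero; suc; _≤_; ∣_-_∣)
open import Data.Bool using (Bool; true; false; not; if_then_else_)
open import Data.Fin using (Fin; toℕ; _≟_)
open import Data.Fin.Subset using (Subset; _∈_; _∉_; _⊆_; ∁; ∣_∣)
open import Data.Product using (Σ; ∃; _×_; _,_)
open import Data.Sum using (_⊎_)
open import Data.Empty using (⊥; ⊥-elim)
open import Relation.Nullary using (¬_; yes; no)
open import Relation.Nullary.Decidable using (⌊_⌋)
open import Relation.Binary.PropositionalEquality using (_≡_; _≢_; refl; sym; cong)
open import Function.Definitions using (Injective)

record Graph (n : ℕ) : Set where
  field
    adj     : Fin n → Fin n → Bool
    adj-sym : ∀ u v → adj u v ≡ adj v u
    adj-irr : ∀ u → adj u u ≡ false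
open Graph public

Adj : ∀ {n} → Graph n → Fin n → Fin n → Set
Adj G u v = adj G u v ≡ true

complAdj : ∀ {n} → Graph n → Fin n → Fin n → Bool
complAdj G u v = if ⌊ u ≟ v ⌋ then false else not (adj G u v)

complAdj-sym : ∀ {n} (G : Graph n) u v → complAdj G u v ≡ complAdj G v u
complAdj-sym G u v with u ≟ v | v ≟ u
... | yes _   | yes _   = refl
... | yes u≡v | no  v≢u = ⊥-elim (v≢u (sym u≡v))
... | no  u≢v | yes v≡u = ⊥-elim (u≢v (sym v≡u))
... | no  _   | no  _   = cong not (adj-sym G u v)

complAdj-irr : ∀ {n} (G : Graph n) u → complAdj G u u ≡ false
complAdj-irr G u with u ≟ u
... | yes _ = refl
... | no u≢u = ⊥-elim (u≢u refl)

complement : ∀ {n} → Graph n → Graph n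
complement G = record
  { adj = complAdj G ; adj-sym = complAdj-sym G ; adj-irr = complAdj-irr G }

data Walk {n} (G : Graph n) : Fin n → Fin n → Set where
  here : ∀ {u} → Walk G u u
  step : ∀ {u v w} → Adj G u v → Walk G v w → Walk G u w

Connected : ∀ {n} → Graph n → Set
Connected G = ∀ u v → Walk G u v

IsBipartition : ∀ {n} → Graph n → Subset n → Set
IsBipartition G A = ∀ u v → Adj G u v → (u ∈ A × v ∉ A) ⊎ (u ∉ A × v ∈ A)

IsInducedP5 : ∀ {n} → Graph n → (Fin 5 → Fin n) → Set
IsInducedP5 G f = Injective _≡_ _≡_ f ×
  (∀ i j → (Adj G (f i) (f j) → ∣ toℕ i - toℕ j ∣ ≡ 1)
         × (∣ toℕ i - toℕ j ∣ ≡ 1 → Adj G (f i) (f j)))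

P5Free : ∀ {n} → Graph n → Set
P5Free G = ∀ f → ¬ IsInducedP5 G f

CycConsec : (k : ℕ) → ∀ {m} → Fin m → Fin m → Set
CycConsec k i j =
    (suc (toℕ i) ≡ toℕ j) ⊎ (suc (toℕ j) ≡ toℕ i)
  ⊎ (suc (toℕ i) ≡ k × toℕ j ≡ 0) ⊎ (suc (toℕ j) ≡ k × toℕ i ≡ 0)

IsCycle : ∀ {n} → Graph n → (k : ℕ) → (Fin k → Fin n) → Set
IsCycle G k c = 3 ≤ k × Injective _≡_ _≡_ c
  × (∀ i j → CycConsec k i j → Adj G (c i) (c j))

HasChord : ∀ {n} → Graph n → (k : ℕ) → (Fin k → Fin n) → Set
HasChord G k c = Σ (Fin k) λ i → Σ (Fin k) λ j →
  i ≢ j × ¬ CycConsec k i j × Adj G (c i) (c j)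

IsChordalBipartite : ∀ {n} → Graph n → Subset n → Set
IsChordalBipartite G A = IsBipartition G A ×
  (∀ k c → 6 ≤ k → IsCycle G k c → HasChord G k c)

Hamiltonian : ∀ {n} → Graph n → Set
Hamiltonian {n} G = Σ (Fin n → Fin n) λ c → IsCycle G n c

IsBiclique : ∀ {n} → Graph n → Subset n → Subset n → Subset n → Set
IsBiclique G A X Y = X ⊆ A × Y ⊆ ∁ A × (∀ x y → x ∈ X → y ∈ Y → Adj G x y)

IsMaximalBiclique : ∀ {n} → Graph n → Subset n → Subset n → Subset n → Set
IsMaximalBiclique G A X Y = IsBiclique G A X Y
  × (∀ a → a ∈ A → a ∉ X → ¬ (∀ y → y ∈ Y → Adj G a y))
  × (∀ b → b ∈ ∁ A → b ∉ Y → ¬ (∀ x → x ∈ X → Adj G x b))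

-- Maximum biclique (as in the paper): a maximal biclique minimising ||X| - |Y||
-- among all maximal bicliques.
IsMaximumBiclique : ∀ {n} → Graph n → Subset n → Subset n → Subset n → Set
IsMaximumBiclique G A X Y = IsMaximalBiclique G A X Y
  × (∀ X' Y' → IsMaximalBiclique G A X' Y' → ∣ ∣ X ∣ - ∣ Y ∣ ∣ ≤ ∣ ∣ X' ∣ - ∣ Y' ∣ ∣)

{-# OPTIONS --safe #-}
-- In the complement of a bipartite graph both sides of the bipartition are
-- cliques, so a Hamiltonian cycle of the complement only needs two disjoint
-- non-edges of G crossing the bipartition. Maximality of the biclique
-- (A₁, B₁) supplies them: a ∈ A ∖ A₁ has a non-neighbour y ∈ B₁ and
-- b ∈ B ∖ B₁ a non-neighbour x ∈ A₁. The cycle runs from a through A to x,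
-- crosses to b, runs through B to y and closes back to a.
module Submission where

open import Defs
open import Data.Nat using (ℕ)
open import Data.Fin.Subset using (Subset; _∈_; _∉_; ∁)
open import Data.Product using (∃; _×_)

open import Level using (Level)
open import Data.Nat using (suc; _≤_; _<_; _+_; s≤s)
open import Data.Nat.Properties using (≤-antisym; ≮⇒≥; n≤1+n; m≤n+m; +-mono-≤; suc-injective; module ≤-Reasoning)
open import Data.Bool using (true; false; _≟_)
open import Data.Fin as Fin using (Fin; toℕ; cast)
open import Data.Fin.Properties using (toℕ-cast; toℕ-injective; pigeonhole; ¬∀⟶∃¬; <⇒≢)
open import Data.Fin.Subset.Properties using (_∈?_; x∈∁p⇒x∉p)
open import Data.List using (List; []; _∷_; _++_; length; filter; allFin; lookup; head; last)
open import Data.List.Properties using (length-++)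
open import Data.List.Membership.Propositional using () renaming (_∈_ to _∈ₗ_)
open import Data.List.Membership.Propositional.Properties using (∈-filter⁺; ∈-++⁺ˡ; ∈-++⁺ʳ; ∈-allFin; ∈-lookup)
open import Data.List.Relation.Unary.All using (All; []; _∷_)
import Data.List.Relation.Unary.All as All
import Data.List.Relation.Unary.All.Properties as All
open import Data.List.Relation.Unary.Any using (here; there; index)
open import Data.List.Relation.Unary.Any.Properties using (lookup-index)
open import Data.List.Relation.Unary.AllPairs using ([]; _∷_)
open import Data.List.Relation.Unary.Linked using (Linked; []; [-]; _∷_)
import Data.List.Relation.Unary.Linked.Properties as Linked
open import Data.List.Relation.Unary.Unique.Propositional using (Unique)
import Data.List.Relation.Unary.Unique.Propositional.Properties as Unique
open import Data.Maybe using (just)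
import Data.Maybe.Relation.Binary.Connected as Maybe
open import Data.Product using (_,_; proj₁; proj₂)
open import Data.Sum using (inj₁; inj₂)
open import Data.Empty using (⊥-elim)
open import Relation.Nullary using (¬_; yes; no; Dec)
open import Relation.Nullary.Decidable using (_×-dec_; ¬?; _→-dec_)
open import Relation.Unary using (Pred; Decidable)
open import Relation.Binary.PropositionalEquality using (_≡_; _≢_; refl; sym; trans; cong; subst; subst₂; module ≡-Reasoning)

private
  variable
    a ℓ : Level
    T : Set a

lookup-Linked : ∀ {R : T → T → Set ℓ} {xs} → Linked R xs → (i j : Fin (length xs))
              → suc (toℕ i) ≡ toℕ j → R (lookup xs i) (lookup xs j)
lookup-Linked (r ∷ _)  Fin.zero    (Fin.suc Fin.zero) _ = r
lookup-Linked (_ ∷ rs) (Fin.suc i) (Fin.suc j)        e = lookup-Linked rs i j (suc-injective e)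

lookup-last : ∀ (xs : List T) (i : Fin (length xs)) → suc (toℕ i) ≡ length xs
            → last xs ≡ just (lookup xs i)
lookup-last (_ ∷ [])     Fin.zero    _ = refl
lookup-last (_ ∷ y ∷ ys) (Fin.suc i) e = lookup-last (y ∷ ys) i (suc-injective e)

lookup-head : ∀ (xs : List T) (i : Fin (length xs)) → toℕ i ≡ 0 → head xs ≡ just (lookup xs i)
lookup-head (_ ∷ _) Fin.zero _ = refl

last-++ : ∀ (xs : List T) {y ys} → last (xs ++ y ∷ ys) ≡ last (y ∷ ys)
last-++ []           = refl
last-++ (_ ∷ [])     = refl
last-++ (_ ∷ x ∷ xs) = last-++ (x ∷ xs)

lookup-injective : ∀ {xs : List T} → Unique xs → (i j : Fin (length xs))
                 → lookup xs i ≡ lookup xs j → i ≡ j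
lookup-injective (_  ∷ _) Fin.zero    Fin.zero    _ = refl
lookup-injective (x≢ ∷ _) Fin.zero    (Fin.suc j) e = ⊥-elim (All.lookup x≢ (∈-lookup j) e)
lookup-injective (x≢ ∷ _) (Fin.suc i) Fin.zero    e = ⊥-elim (All.lookup x≢ (∈-lookup i) (sym e))
lookup-injective (_  ∷ u) (Fin.suc i) (Fin.suc j) e = cong Fin.suc (lookup-injective u i j e)

length-enumeration : ∀ {n} (xs : List (Fin n)) → Unique xs → (∀ v → v ∈ₗ xs) → length xs ≡ n
length-enumeration {n} xs unique complete = ≤-antisym (≮⇒≥ too-long) (≮⇒≥ too-short)
  where
  too-long : ¬ (n < length xs)
  too-long n<len with pigeonhole n<len (lookup xs)
  ... | i , j , i<j , e = <⇒≢ i<j (lookup-injective unique i j e)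

  too-short : ¬ (length xs < n)
  too-short len<n with pigeonhole len<n (λ v → index (complete v))
  ... | u , v , u<v , e = <⇒≢ u<v (begin
    u                              ≡⟨ lookup-index (complete u) ⟩
    lookup xs (index (complete u)) ≡⟨ cong (lookup xs) e ⟩
    lookup xs (index (complete v)) ≡⟨ lookup-index (complete v) ⟨
    v                              ∎)
    where open ≡-Reasoning

Linked-clique : ∀ {p} {S : T → Set p} {R : T → T → Set ℓ}
              → (∀ {u v} → S u → S v → u ≢ v → R u v)
              → ∀ {xs} → All S xs → Unique xs → Linked R xs
Linked-clique R-S []             []                    = []
Linked-clique R-S (_ ∷ [])       _                     = [-]
Linked-clique R-S (su ∷ sv ∷ ss) ((u≢v ∷ _) ∷ unique) =
  R-S su sv u≢v ∷ Linked-clique R-S (sv ∷ ss) unique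

module _ {n p} {S : Pred (Fin n) p} (S? : Decidable S) (s t : Fin n) where

  private
    Interior : Pred (Fin n) p
    Interior v = S v × v ≢ s × v ≢ t

    interior : List (Fin n)
    interior = filter (λ v → S? v ×-dec ¬? (v Fin.≟ s) ×-dec ¬? (v Fin.≟ t)) (allFin n)

    All-interior : All Interior interior
    All-interior = All.all-filter _ (allFin n)

  listFromTo : List (Fin n)
  listFromTo = s ∷ interior ++ t ∷ []

  All-listFromTo : S s → S t → All S listFromTo
  All-listFromTo Ss St = Ss ∷ All.++⁺ (All.map proj₁ All-interior) (St ∷ [])

  listFromTo-unique : s ≢ t → Unique listFromTo
  listFromTo-unique s≢t =
    All.++⁺ (All.map (λ (_ , v≢s , _) s≡v → v≢s (sym s≡v)) All-interior) (s≢t ∷ [])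
    ∷ Unique.++⁺ (Unique.filter⁺ _ (Unique.allFin⁺ n)) ([] ∷ []) t∉interior
    where
    t∉interior : ∀ {v} → ¬ (v ∈ₗ interior × v ∈ₗ t ∷ [])
    t∉interior (v∈ , here refl) = proj₂ (proj₂ (All.lookup All-interior v∈)) refl

  ∈-listFromTo : ∀ {v} → S v → v ∈ₗ listFromTo
  ∈-listFromTo {v} Sv with v Fin.≟ s | v Fin.≟ t
  ... | yes refl | _        = here refl
  ... | no _     | yes refl = there (∈-++⁺ʳ interior (here refl))
  ... | no v≢s   | no v≢t   = there (∈-++⁺ˡ (∈-filter⁺ _ (∈-allFin v) (Sv , v≢s , v≢t)))

  last-listFromTo : last listFromTo ≡ just t
  last-listFromTo = last-++ (s ∷ interior)

  length-listFromTo : 2 ≤ length listFromTo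
  length-listFromTo = s≤s (subst (1 ≤_) (sym (length-++ interior)) (m≤n+m 1 (length interior)))

module _ {n} (H : Graph n) where

  Adj-sym : ∀ {u v} → Adj H u v → Adj H v u
  Adj-sym {u} {v} uv = trans (adj-sym H v u) uv

  hamiltonian-from-listing : (xs : List (Fin n)) → 3 ≤ length xs → Unique xs → (∀ v → v ∈ₗ xs)
                           → Linked (Adj H) xs → Maybe.Connected (Adj H) (last xs) (head xs)
                           → Hamiltonian H
  hamiltonian-from-listing xs 3≤len unique complete linked closing =
    c , subst (3 ≤_) len≡n 3≤len , c-injective , c-adjacent
    where
    len≡n : length xs ≡ n
    len≡n = length-enumeration xs unique complete

    position : Fin n → Fin (length xs)
    position = cast (sym len≡n)

    toℕ-position : ∀ i → toℕ (position i) ≡ toℕ i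
    toℕ-position = toℕ-cast (sym len≡n)

    c : Fin n → Fin n
    c i = lookup xs (position i)

    c-injective : ∀ {i j} → c i ≡ c j → i ≡ j
    c-injective {i} {j} e = toℕ-injective (begin
      toℕ i            ≡⟨ sym (toℕ-position i) ⟩
      toℕ (position i) ≡⟨ cong toℕ (lookup-injective unique (position i) (position j) e) ⟩
      toℕ (position j) ≡⟨ toℕ-position j ⟩
      toℕ j            ∎)
      where open ≡-Reasoning

    successor : ∀ i j → suc (toℕ i) ≡ toℕ j → Adj H (c i) (c j)
    successor i j e = lookup-Linked linked (position i) (position j)
      (trans (cong suc (toℕ-position i)) (trans e (sym (toℕ-position j))))

    wrap-around : ∀ i j → suc (toℕ i) ≡ n → toℕ j ≡ 0 → Adj H (c i) (c j)
    wrap-around i j i-last j-first = Maybe.drop-just (subst₂ (Maybe.Connected (Adj H))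
      (lookup-last xs (position i) (trans (cong suc (toℕ-position i)) (trans i-last (sym len≡n))))
      (lookup-head xs (position j) (trans (toℕ-position j) j-first))
      closing)

    c-adjacent : ∀ i j → CycConsec n i j → Adj H (c i) (c j)
    c-adjacent i j (inj₁ e)                     = successor i j e
    c-adjacent i j (inj₂ (inj₁ e))              = Adj-sym (successor j i e)
    c-adjacent i j (inj₂ (inj₂ (inj₁ (e , z)))) = wrap-around i j e z
    c-adjacent i j (inj₂ (inj₂ (inj₂ (e , z)))) = Adj-sym (wrap-around j i e z)

complement-adj : ∀ {n} (G : Graph n) {u v} → u ≢ v → ¬ Adj G u v → Adj (complement G) u v
complement-adj G {u} {v} u≢v u≁v with u Fin.≟ v
... | yes u≡v = ⊥-elim (u≢v u≡v)
... | no _ with adj G u v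
...   | true  = ⊥-elim (u≁v refl)
...   | false = refl

module _ {n} (G : Graph n) (A : Subset n) (bipartite : IsBipartition G A) where

  ∈-independent : ∀ {u v} → u ∈ A → v ∈ A → ¬ Adj G u v
  ∈-independent u∈A v∈A uv with bipartite _ _ uv
  ... | inj₁ (_ , v∉A) = v∉A v∈A
  ... | inj₂ (u∉A , _) = u∉A u∈A

  ∉-independent : ∀ {u v} → u ∉ A → v ∉ A → ¬ Adj G u v
  ∉-independent u∉A v∉A uv with bipartite _ _ uv
  ... | inj₁ (u∈A , _) = u∉A u∈A
  ... | inj₂ (_ , v∈A) = v∉A v∈A

  complement-hamiltonian : ∀ {a x b y} → a ∈ A → x ∈ A → b ∉ A → y ∉ A → a ≢ x → b ≢ y
                         → ¬ Adj G x b → ¬ Adj G a y → Hamiltonian (complement G)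
  complement-hamiltonian {a} {x} {b} {y} a∈A x∈A b∉A y∉A a≢x b≢y x≁b a≁y =
    hamiltonian-from-listing (complement G) cycle long-enough unique complete linked closes
    where
    _∈A? : Decidable (_∈ A)
    _∈A? = _∈? A

    _∉A? : Decidable (_∉ A)
    _∉A? v = ¬? (v ∈? A)

    sideA = listFromTo _∈A? a x
    sideB = listFromTo _∉A? b y
    cycle = sideA ++ sideB

    uniqueA = listFromTo-unique _∈A? a x a≢x
    uniqueB = listFromTo-unique _∉A? b y b≢y
    allA = All-listFromTo _∈A? a x a∈A x∈A
    allB = All-listFromTo _∉A? b y b∉A y∉A

    long-enough : 3 ≤ length cycle
    long-enough = begin
      3                             ≤⟨ n≤1+n 3 ⟩
      2 + 2                         ≤⟨ +-mono-≤ (length-listFromTo _∈A? a x) (length-listFromTo _∉A? b y) ⟩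
      length sideA + length sideB   ≡⟨ length-++ sideA ⟨
      length cycle                  ∎
      where open ≤-Reasoning

    unique : Unique cycle
    unique = Unique.++⁺ uniqueA uniqueB
      (λ (v∈sideA , v∈sideB) → All.lookup allB v∈sideB (All.lookup allA v∈sideA))

    complete : ∀ v → v ∈ₗ cycle
    complete v with v ∈? A
    ... | yes v∈A = ∈-++⁺ˡ (∈-listFromTo _∈A? a x v∈A)
    ... | no  v∉A = ∈-++⁺ʳ sideA (∈-listFromTo _∉A? b y v∉A)

    crossing : ∀ {u v} → u ∈ A → v ∉ A → ¬ Adj G u v → Adj (complement G) u v
    crossing u∈A v∉A = complement-adj G (λ { refl → v∉A u∈A })

    linked : Linked (Adj (complement G)) cycle
    linked = Linked.++⁺
      (Linked-clique (λ u∈A v∈A u≢v → complement-adj G u≢v (∈-independent u∈A v∈A)) allA uniqueA)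
      (subst (λ l → Maybe.Connected _ l (just b)) (sym (last-listFromTo _∈A? a x))
        (Maybe.just (crossing x∈A b∉A x≁b)))
      (Linked-clique (λ u∉A v∉A u≢v → complement-adj G u≢v (∉-independent u∉A v∉A)) allB uniqueB)

    closes : Maybe.Connected (Adj (complement G)) (last cycle) (head cycle)
    closes = subst (λ l → Maybe.Connected _ l (just a))
      (sym (trans (last-++ sideA) (last-listFromTo _∉A? b y)))
      (Maybe.just (Adj-sym (complement G) (crossing a∈A y∉A a≁y)))

∃-counterexample : ∀ {n p q} {P : Pred (Fin n) p} {Q : Pred (Fin n) q} → Decidable P → Decidable Q
                 → ¬ (∀ v → P v → Q v) → ∃ λ v → P v × ¬ Q v
∃-counterexample {n} P? Q? ¬P⊆Q with ¬∀⟶∃¬ n _ (λ v → P? v →-dec Q? v) ¬P⊆Q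
... | v , ¬[Pv→Qv] with P? v
...   | yes Pv = v , Pv , λ Qv → ¬[Pv→Qv] (λ _ → Qv)
...   | no ¬Pv = ⊥-elim (¬[Pv→Qv] (λ Pv → ⊥-elim (¬Pv Pv)))

Adj? : ∀ {n} (G : Graph n) u v → Dec (Adj G u v)
Adj? G u v = adj G u v ≟ true

module _ {n} (G : Graph n) (A : Subset n) {X Y : Subset n} (maximal : IsMaximalBiclique G A X Y) where

  nonNeighbour-in-Y : ∀ {a} → a ∈ A → a ∉ X → ∃ λ y → y ∈ Y × ¬ Adj G a y
  nonNeighbour-in-Y a∈A a∉X = ∃-counterexample (_∈? Y) (Adj? G _) (proj₁ (proj₂ maximal) _ a∈A a∉X)

  nonNeighbour-in-X : ∀ {b} → b ∈ ∁ A → b ∉ Y → ∃ λ x → x ∈ X × ¬ Adj G x b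
  nonNeighbour-in-X b∈B b∉Y = ∃-counterexample (_∈? X) (λ x → Adj? G x _) (proj₂ (proj₂ maximal) _ b∈B b∉Y)

theorem17 : ∀ {n} (G : Graph n) (A A₁ B₁ : Subset n)
    → Connected G → P5Free G → IsChordalBipartite G A
    → IsMaximumBiclique G A A₁ B₁
    → ∃ (λ a → a ∈ A × a ∉ A₁) → ∃ (λ b → b ∈ ∁ A × b ∉ B₁)
    → Hamiltonian G → Hamiltonian (complement G)
theorem17 G A A₁ B₁ _ _ (bipartite , _) (maximal@((A₁⊆A , B₁⊆∁A , _) , _) , _) (a , a∈A , a∉A₁) (b , b∈B , b∉B₁) _
  with nonNeighbour-in-Y G A maximal a∈A a∉A₁ | nonNeighbour-in-X G A maximal b∈B b∉B₁
... | y , y∈B₁ , a≁y | x , x∈A₁ , x≁b =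
  complement-hamiltonian G A bipartite a∈A (A₁⊆A x∈A₁) (x∈∁p⇒x∉p b∈B) (x∈∁p⇒x∉p (B₁⊆∁A y∈B₁))
    (λ { refl → a∉A₁ x∈A₁ }) (λ { refl → b∉B₁ y∈B₁ })
    x≁b a≁y
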